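{- If $G$ is a special Roman graph, then $\gamma_R(\mu(G))=\gamma_R(G)+1$.
   Context: All graphs are finite and simple. A Roman dominating function (RDF) of $G=(V,E)$ is a function $f:V\to\{0,1,2\}$ such that every vertex $v$ with $f(v)=0$ has a neighbor $w$ with $f(w)=2$; its weight is $\sum_{v}f(v)$, $\gamma_R(G)$ is the minimum weight of an RDF, and a $\gamma_R$-function is an RDF of weight $\gamma_R(G)$. Write $f=(V_0,V_1,V_2)$ with $V_i=\{v: f(v)=i\}$. $G$ is a special Roman graph if it has a $\gamma_R$-function $f=(V_0,V_1,V_2)$ with $V_1=\emptyset$ such that the induced subgraph $G[V_2]$ has no isolated vertex. The Mycielskian $\mu(G)$ of $G$ with $V(G)=\{v_1^0,\ldots,v_n^0\}$ has vertex set $\{v_j^0\}\cup\{v_j^1\}\cup\{u\}$ and edge set $E(G)\cup\{v_j^0v_{j'}^1 : v_j^0v_{j'}^0\in E(G)\}\cup\{v_j^1u: 1\leq j\leq n\}$. -}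

module Defs where

open import Data.Nat using (ℕ; zero; suc; _+_; _≤_)
open import Data.Fin using (Fin; splitAt)
open import Data.Bool using (Bool; true; false; T; not)
open import Data.Sum using (_⊎_; inj₁; inj₂)
open import Data.Product using (Σ; ∃; _×_; _,_)
open import Data.List using (List; map; allFin)
open import Data.Nat.ListAction using (sum)
open import Relation.Nullary using (¬_)
open import Relation.Binary.PropositionalEquality using (_≡_)

record Graph (n : ℕ) : Set where
  field
    adj     : Fin n → Fin n → Bool
    sym     : ∀ i j → adj i j ≡ adj j i
    irrefl  : ∀ i → adj i i ≡ false
open Graph public

Adj : ∀ {n} → Graph n → Fin n → Fin n → Set
Adj G i j = T (adj G i j)

Labelling : ℕ → Set
Labelling n = Fin n → Fin 3

val : Fin 3 → ℕ
val Fin.zero = 0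
val (Fin.suc Fin.zero) = 1
val (Fin.suc (Fin.suc Fin.zero)) = 2

_≐_ : Fin 3 → ℕ → Set
a ≐ i = val a ≡ i

weight : ∀ {n} → Labelling n → ℕ
weight {n} f = sum (map (λ v → val (f v)) (allFin n))

IsRDF : ∀ {n} → Graph n → Labelling n → Set
IsRDF {n} G f = ∀ v → f v ≐ 0 → ∃ λ w → Adj G v w × (f w ≐ 2)

IsγR : ∀ {n} → Graph n → ℕ → Set
IsγR G k = (Σ (Labelling _) λ f → IsRDF G f × weight f ≡ k)
         × (∀ f → IsRDF G f → k ≤ weight f)

IsγRFunction : ∀ {n} → Graph n → Labelling n → Set
IsγRFunction G f = IsRDF G f × IsγR G (weight f)

SpecialRoman : ∀ {n} → Graph n → Set
SpecialRoman {n} G = Σ (Labelling n) λ f →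
  IsγRFunction G f
  × (∀ v → ¬ (f v ≐ 1))
  × (∀ v → f v ≐ 2 → ∃ λ w → Adj G v w × (f w ≐ 2))

-- Mycielskian. Vertex set Fin ((n + n) + 1): first block = v_j^0,
-- second block = v_j^1, last vertex = u.
data MVert (n : ℕ) : Set where
  orig copy : Fin n → MVert n
  hub       : MVert n

decode : ∀ n → Fin ((n + n) + 1) → MVert n
decode n x with splitAt (n + n) x
... | inj₂ _ = hub
... | inj₁ y with splitAt n y
...   | inj₁ i = orig i
...   | inj₂ j = copy j

madj : ∀ {n} → Graph n → MVert n → MVert n → Bool
madj G (orig i) (orig j) = adj G i j
madj G (orig i) (copy j) = adj G i j
madj G (copy i) (orig j) = adj G i j
madj G (copy i) (copy j) = false
madj G (copy i) hub      = true
madj G hub (copy j)      = true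
madj G (orig i) hub      = false
madj G hub (orig j)      = false
madj G hub hub           = false

madj-sym : ∀ {n} (G : Graph n) a b → madj G a b ≡ madj G b a
madj-sym G (orig i) (orig j) = sym G i j
madj-sym G (orig i) (copy j) = sym G i j
madj-sym G (copy i) (orig j) = sym G i j
madj-sym G (copy i) (copy j) = Relation.Binary.PropositionalEquality.refl
madj-sym G (copy i) hub      = Relation.Binary.PropositionalEquality.refl
madj-sym G hub (copy j)      = Relation.Binary.PropositionalEquality.refl
madj-sym G (orig i) hub      = Relation.Binary.PropositionalEquality.refl
madj-sym G hub (orig j)      = Relation.Binary.PropositionalEquality.refl
madj-sym G hub hub           = Relation.Binary.PropositionalEquality.refl

madj-irr : ∀ {n} (G : Graph n) a → madj G a a ≡ false
madj-irr G (orig i) = irrefl G i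
madj-irr G (copy i) = Relation.Binary.PropositionalEquality.refl
madj-irr G hub      = Relation.Binary.PropositionalEquality.refl

μ : ∀ {n} → Graph n → Graph ((n + n) + 1)
μ {n} G = record
  { adj    = λ x y → madj G (decode n x) (decode n y)
  ; sym    = λ x y → madj-sym G (decode n x) (decode n y)
  ; irrefl = λ x → madj-irr G (decode n x)
  }

-- An RDF of G with V₁ = ∅ and no isolated vertex in G[V₂] extends to μ(G) by
-- labelling every copy v¹ with 0 and the hub u with 1: a copy v¹ is dominated
-- through v's 2-labelled neighbour w (via w⁰), which exists whether f(v) = 0 or
-- f(v) = 2. Conversely, an RDF g of μ(G) collapses onto G, v ↦ max(g(v⁰), g(v¹)),
-- losing at least 1 of weight: if g(u) > 0 the hub is simply dropped, and if
-- g(u) = 0 then some copy w¹ carries a 2, which may be replaced by 1 when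
-- collapsing v ↦ max(g(v⁰), min(g(v¹), 1)).
module Submission where

open import Defs
open import Data.Nat using (ℕ; zero; suc; _+_; _≤_; _<_; z≤n; s≤s)
open import Data.Nat.Properties
open import Algebra.Properties.CommutativeMonoid.Sum +-0-commutativeMonoid
  using (sum; sum-syntax; ∑-distrib-+; sum-replicate-zero)
import Data.Nat.ListAction as List
open import Data.Fin using (Fin; zero; suc; splitAt; _↑ˡ_; _↑ʳ_; join)
open import Data.Fin.Patterns using (0F; 1F; 2F)
open import Data.Fin.Properties using (splitAt-↑ˡ; splitAt-↑ʳ; join-splitAt)
open import Data.Bool using (T)
open import Data.Sum using (_⊎_; inj₁; inj₂)
open import Data.Product as Product using (Σ; ∃; _×_; _,_; proj₁; proj₂)
open import Data.List using (tabulate; allFin)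
open import Data.List.Properties using (map-tabulate; map-cong)
open import Function using (_∘_; id)
open import Relation.Nullary using (¬_; contradiction)
open import Relation.Binary.PropositionalEquality as ≡
  using (_≡_; _≗_; refl; trans; cong; cong₂; subst; subst₂)

∑-tabulate : ∀ {n} (f : Fin n → ℕ) → List.sum (tabulate f) ≡ ∑[ i < n ] f i
∑-tabulate {zero}  f = refl
∑-tabulate {suc n} f = cong (f 0F +_) (∑-tabulate (f ∘ suc))

∑-↑ : ∀ m n (f : Fin (m + n) → ℕ) →
      sum f ≡ sum (f ∘ (_↑ˡ n)) + sum (f ∘ (m ↑ʳ_))
∑-↑ zero    n f = refl
∑-↑ (suc m) n f = trans (cong (f 0F +_) (∑-↑ m n (f ∘ suc)))
                        (≡.sym (+-assoc (f 0F) _ _))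

∑-mono-≤ : ∀ {n} {f g : Fin n → ℕ} → (∀ i → f i ≤ g i) → sum f ≤ sum g
∑-mono-≤ {zero}  f≤g = z≤n
∑-mono-≤ {suc n} f≤g = +-mono-≤ (f≤g 0F) (∑-mono-≤ (f≤g ∘ suc))

∑-mono-< : ∀ {n} {f g : Fin n → ℕ} → (∀ i → f i ≤ g i) →
           ∀ i → f i < g i → sum f < sum g
∑-mono-< f≤g zero    fi<gi = +-mono-<-≤ fi<gi (∑-mono-≤ (f≤g ∘ suc))
∑-mono-< f≤g (suc i) fi<gi = +-mono-≤-< (f≤g 0F) (∑-mono-< (f≤g ∘ suc) i fi<gi)

weight≡∑ : ∀ {n} (f : Labelling n) → weight f ≡ ∑[ v < n ] val (f v)
weight≡∑ f = trans (cong List.sum (map-tabulate id (val ∘ f))) (∑-tabulate (val ∘ f))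

weight-cong : ∀ {n} {f g : Labelling n} → f ≗ g → weight f ≡ weight g
weight-cong {n} f≗g = cong List.sum (map-cong (cong val ∘ f≗g) (allFin n))

weight-zero : ∀ {n} → weight {n} (λ _ → 0F) ≡ 0
weight-zero {n} = trans (weight≡∑ {n} (λ _ → 0F)) (sum-replicate-zero n)

infixl 25 _⊔_

_⊔_ : Fin 3 → Fin 3 → Fin 3
0F ⊔ b  = b
1F ⊔ 2F = 2F
1F ⊔ _  = 1F
2F ⊔ _  = 2F

sign : Fin 3 → Fin 3
sign 0F = 0F
sign _  = 1F

≐0⊎≥1 : ∀ a → a ≐ 0 ⊎ 1 ≤ val a
≐0⊎≥1 0F = inj₁ refl
≐0⊎≥1 1F = inj₂ (s≤s z≤n)
≐0⊎≥1 2F = inj₂ (s≤s z≤n)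

⊔-≐0 : ∀ a b → a ⊔ b ≐ 0 → a ≐ 0 × b ≐ 0
⊔-≐0 0F 0F _  = refl , refl
⊔-≐0 0F 1F ()
⊔-≐0 0F 2F ()
⊔-≐0 1F 0F ()
⊔-≐0 1F 1F ()
⊔-≐0 1F 2F ()
⊔-≐0 2F _  ()

⊔-≐2ˡ : ∀ a b → a ≐ 2 → a ⊔ b ≐ 2
⊔-≐2ˡ 2F b _ = refl

⊔-≐2ʳ : ∀ a b → b ≐ 2 → a ⊔ b ≐ 2
⊔-≐2ʳ 0F 2F _ = refl
⊔-≐2ʳ 1F 2F _ = refl
⊔-≐2ʳ 2F 2F _ = refl

sign-≐0 : ∀ a → sign a ≐ 0 → a ≐ 0
sign-≐0 0F _ = refl

val-⊔-≤ : ∀ a b → val (a ⊔ b) ≤ val a + val b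
val-⊔-≤ 0F b  = ≤-refl
val-⊔-≤ 1F 0F = ≤-refl
val-⊔-≤ 1F 1F = s≤s z≤n
val-⊔-≤ 1F 2F = s≤s (s≤s z≤n)
val-⊔-≤ 2F b  = m≤m+n 2 (val b)

val-sign-≤ : ∀ a → val (sign a) ≤ val a
val-sign-≤ 0F = z≤n
val-sign-≤ 1F = ≤-refl
val-sign-≤ 2F = s≤s z≤n

val-sign-< : ∀ a → a ≐ 2 → val (sign a) < val a
val-sign-< 2F _ = ≤-refl

weight-⊔-≤ : ∀ {n} (f g : Labelling n) → weight (λ v → f v ⊔ g v) ≤ weight f + weight g
weight-⊔-≤ {n} f g = begin
  weight (λ v → f v ⊔ g v)               ≡⟨ weight≡∑ (λ v → f v ⊔ g v) ⟩
  ∑[ v < n ] val (f v ⊔ g v)             ≤⟨ ∑-mono-≤ (λ v → val-⊔-≤ (f v) (g v)) ⟩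
  ∑[ v < n ] (val (f v) + val (g v))     ≡⟨ ∑-distrib-+ (val ∘ f) (val ∘ g) ⟩
  ∑[ v < n ] val (f v) + ∑[ v < n ] val (g v)
                                         ≡⟨ cong₂ _+_ (weight≡∑ f) (weight≡∑ g) ⟨
  weight f + weight g                    ∎
  where open ≤-Reasoning

weight-mono-< : ∀ {n} {f g : Labelling n} → (∀ v → val (f v) ≤ val (g v)) →
                ∀ w → val (f w) < val (g w) → weight f < weight g
weight-mono-< {f = f} {g} f≤g w fw<gw =
  subst₂ _<_ (≡.sym (weight≡∑ f)) (≡.sym (weight≡∑ g)) (∑-mono-< f≤g w fw<gw)

weight-sign-< : ∀ {n} (f : Labelling n) w → f w ≐ 2 → weight (sign ∘ f) < weight f
weight-sign-< f w fw≐2 = weight-mono-< (val-sign-≤ ∘ f) w (val-sign-< (f w) fw≐2)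

weight-⊔-sign-< : ∀ {n} (f g : Labelling n) w → g w ≐ 2 →
                  weight (λ v → f v ⊔ sign (g v)) < weight f + weight g
weight-⊔-sign-< f g w gw≐2 =
  ≤-<-trans (weight-⊔-≤ f (sign ∘ g)) (+-monoʳ-< (weight f) (weight-sign-< g w gw≐2))

IsγR-unique : ∀ {n} {G : Graph n} {k l} → IsγR G k → IsγR G l → k ≡ l
IsγR-unique ((f , f-rdf , wf≡k) , k≤) ((g , g-rdf , wg≡l) , l≤) =
  ≤-antisym (subst (_ ≤_) wg≡l (k≤ g g-rdf)) (subst (_ ≤_) wf≡k (l≤ f f-rdf))

encode : ∀ n → MVert n → Fin ((n + n) + 1)
encode n (orig i) = (i ↑ˡ n) ↑ˡ 1
encode n (copy i) = (n ↑ʳ i) ↑ˡ 1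
encode n hub      = (n + n) ↑ʳ 0F

decode-encode : ∀ n x → decode n (encode n x) ≡ x
decode-encode n (orig i) rewrite splitAt-↑ˡ (n + n) (i ↑ˡ n) 1 | splitAt-↑ˡ n i n = refl
decode-encode n (copy i) rewrite splitAt-↑ˡ (n + n) (n ↑ʳ i) 1 | splitAt-↑ʳ n n i = refl
decode-encode n hub      rewrite splitAt-↑ʳ (n + n) 1 0F = refl

splitAt⇒join : ∀ m n {i : Fin (m + n)} {s} → splitAt m i ≡ s → join m n s ≡ i
splitAt⇒join m n {i} eq = trans (cong (join m n) (≡.sym eq)) (join-splitAt m n i)

encode-decode : ∀ n x → encode n (decode n x) ≡ x
encode-decode n x with splitAt (n + n) x in eq
... | inj₂ 0F = splitAt⇒join (n + n) 1 eq
... | inj₁ y with splitAt n y in eq′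
...   | inj₁ _ = trans (cong (_↑ˡ 1) (splitAt⇒join n n eq′)) (splitAt⇒join (n + n) 1 eq)
...   | inj₂ _ = trans (cong (_↑ˡ 1) (splitAt⇒join n n eq′)) (splitAt⇒join (n + n) 1 eq)

MLabelling : ℕ → Set
MLabelling n = MVert n → Fin 3

weightᴹ : ∀ {n} → MLabelling n → ℕ
weightᴹ h = weight (h ∘ orig) + weight (h ∘ copy) + val (h hub)

weightᴹ-cong : ∀ {n} {h h′ : MLabelling n} → h ≗ h′ → weightᴹ h ≡ weightᴹ h′
weightᴹ-cong h≗h′ = cong₂ _+_ (cong₂ _+_ (weight-cong (h≗h′ ∘ orig)) (weight-cong (h≗h′ ∘ copy)))
                              (cong val (h≗h′ hub))

weight-μ : ∀ {n} (g : Labelling ((n + n) + 1)) → weight g ≡ weightᴹ (g ∘ encode n)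
weight-μ {n} g = begin
  weight g                                 ≡⟨ weight≡∑ g ⟩
  sum (val ∘ g)                            ≡⟨ ∑-↑ (n + n) 1 (val ∘ g) ⟩
  sum (val ∘ g ∘ (_↑ˡ 1)) + (val gᵘ + 0)   ≡⟨ cong₂ _+_ (∑-↑ n n (val ∘ g ∘ (_↑ˡ 1))) (+-identityʳ (val gᵘ)) ⟩
  sum (val ∘ g⁰) + sum (val ∘ g¹) + val gᵘ ≡⟨ cong (_+ val gᵘ) (cong₂ _+_ (weight≡∑ g⁰) (weight≡∑ g¹)) ⟨
  weightᴹ (g ∘ encode n)                   ∎
  where
  open ≡.≡-Reasoning
  g⁰ g¹ : Labelling n
  g⁰ = g ∘ encode n ∘ orig
  g¹ = g ∘ encode n ∘ copy
  gᵘ : Fin 3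
  gᵘ = g (encode n hub)

weight-decode : ∀ {n} (h : MLabelling n) → weight (h ∘ decode n) ≡ weightᴹ h
weight-decode {n} h = trans (weight-μ {n} (h ∘ decode n)) (weightᴹ-cong (cong h ∘ decode-encode n))

module _ {n} (G : Graph n) where

  IsRDFᴹ : MLabelling n → Set
  IsRDFᴹ h = ∀ x → h x ≐ 0 → ∃ λ y → T (madj G x y) × h y ≐ 2

  IsRDF-μ⇒IsRDFᴹ : ∀ {g} → IsRDF (μ G) g → IsRDFᴹ (g ∘ encode n)
  IsRDF-μ⇒IsRDFᴹ {g} g-rdf x gx≐0 with g-rdf (encode n x) gx≐0
  ... | y , x~y , gy≐2 =
    decode n y ,
    subst (λ x′ → T (madj G x′ (decode n y))) (decode-encode n x) x~y ,
    subst (λ y′ → g y′ ≐ 2) (≡.sym (encode-decode n y)) gy≐2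

  IsRDFᴹ⇒IsRDF-μ : ∀ {h} → IsRDFᴹ h → IsRDF (μ G) (h ∘ decode n)
  IsRDFᴹ⇒IsRDF-μ {h} h-rdf x hx≐0 with h-rdf (decode n x) hx≐0
  ... | y , x~y , hy≐2 =
    encode n y ,
    subst (λ y′ → T (madj G (decode n x) y′)) (≡.sym (decode-encode n y)) x~y ,
    subst (λ y′ → h y′ ≐ 2) (≡.sym (decode-encode n y)) hy≐2

  extend : Labelling n → MLabelling n
  extend f (orig v) = f v
  extend f (copy v) = 0F
  extend f hub      = 1F

  weightᴹ-extend : ∀ f → weightᴹ (extend f) ≡ suc (weight f)
  weightᴹ-extend f = begin
    weight f + weight {n} (λ _ → 0F) + 1 ≡⟨ cong (λ z → weight f + z + 1) (weight-zero {n}) ⟩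
    weight f + 0 + 1                     ≡⟨ cong (_+ 1) (+-identityʳ (weight f)) ⟩
    weight f + 1                         ≡⟨ +-comm (weight f) 1 ⟩
    suc (weight f)                       ∎
    where open ≡.≡-Reasoning

  extend-IsRDFᴹ : ∀ {f} → IsRDF G f → (∀ v → ¬ f v ≐ 1) →
                  (∀ v → f v ≐ 2 → ∃ λ w → Adj G v w × f w ≐ 2) → IsRDFᴹ (extend f)
  extend-IsRDFᴹ f-rdf no-1 two-nbr (orig v) fv≐0 = Product.map orig id (f-rdf v fv≐0)
  extend-IsRDFᴹ {f} f-rdf no-1 two-nbr (copy v) _ with f v in fv
  ... | 0F = Product.map orig id (f-rdf v (cong val fv))
  ... | 1F = contradiction (cong val fv) (no-1 v)
  ... | 2F = Product.map orig id (two-nbr v (cong val fv))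

  extension : ∀ {f} → IsRDF G f → (∀ v → ¬ f v ≐ 1) →
              (∀ v → f v ≐ 2 → ∃ λ w → Adj G v w × f w ≐ 2) →
              Σ (Labelling ((n + n) + 1)) λ g → IsRDF (μ G) g × weight g ≡ suc (weight f)
  extension {f} f-rdf no-1 two-nbr =
    extend f ∘ decode n ,
    IsRDFᴹ⇒IsRDF-μ (extend-IsRDFᴹ f-rdf no-1 two-nbr) ,
    trans (weight-decode (extend f)) (weightᴹ-extend f)

  collapse : MLabelling n → Labelling n
  collapse h v = h (orig v) ⊔ h (copy v)

  collapseSign : MLabelling n → Labelling n
  collapseSign h v = h (orig v) ⊔ sign (h (copy v))

  collapse-IsRDF : ∀ {h} → IsRDFᴹ h → IsRDF G (collapse h)
  collapse-IsRDF {h} h-rdf v hv≐0 with h-rdf (orig v) (proj₁ (⊔-≐0 (h (orig v)) _ hv≐0))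
  ... | orig w , v~w , hw≐2 = w , v~w , ⊔-≐2ˡ (h (orig w)) _ hw≐2
  ... | copy w , v~w , hw≐2 = w , v~w , ⊔-≐2ʳ (h (orig w)) _ hw≐2

  collapseSign-IsRDF : ∀ {h} → IsRDFᴹ h → h hub ≐ 0 → IsRDF G (collapseSign h)
  collapseSign-IsRDF {h} h-rdf hub≐0 v hv≐0
    with h-rdf (copy v) (sign-≐0 (h (copy v)) (proj₂ (⊔-≐0 (h (orig v)) _ hv≐0)))
  ... | orig w , v~w , hw≐2 = w , v~w , ⊔-≐2ˡ (h (orig w)) _ hw≐2
  ... | hub    , _   , hw≐2 = contradiction (trans (≡.sym hub≐0) hw≐2) λ ()

  IsRDFᴹ-weight-≥ : ∀ {k} → (∀ f → IsRDF G f → k ≤ weight f) →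
                    ∀ h → IsRDFᴹ h → suc k ≤ weightᴹ h
  IsRDFᴹ-weight-≥ {k} k≤ h h-rdf with ≐0⊎≥1 (h hub)
  ... | inj₂ 1≤hub = subst (_≤ weightᴹ h) (+-comm k 1)
    (+-mono-≤ (≤-trans (k≤ _ (collapse-IsRDF h-rdf)) (weight-⊔-≤ (h ∘ orig) (h ∘ copy))) 1≤hub)
  ... | inj₁ hub≐0 with h-rdf hub hub≐0
  ...   | copy w , _ , hw≐2 = ≤-trans
    (≤-<-trans (k≤ _ (collapseSign-IsRDF h-rdf hub≐0)) (weight-⊔-sign-< (h ∘ orig) (h ∘ copy) w hw≐2))
    (m≤m+n _ (val (h hub)))

  μ-weight-≥ : ∀ {k} → (∀ f → IsRDF G f → k ≤ weight f) →
               ∀ g → IsRDF (μ G) g → suc k ≤ weight g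
  μ-weight-≥ k≤ g g-rdf =
    subst (_ ≤_) (≡.sym (weight-μ {n} g)) (IsRDFᴹ-weight-≥ k≤ (g ∘ encode n) (IsRDF-μ⇒IsRDFᴹ g-rdf))

theorem2 : ∀ {n} (G : Graph n) → SpecialRoman G →
    ∀ k → IsγR G k → IsγR (μ G) (suc k)
theorem2 G (f , (f-rdf , f-γR) , no-1 , two-nbr) k k-γR@(_ , k≤)
  with refl ← IsγR-unique {G = G} f-γR k-γR =
  extension G f-rdf no-1 two-nbr , μ-weight-≥ G k≤
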